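{- Let $e_1,\dots,e_n$ be the coordinate points of $\mathbb{R}^n$ (the Newton polytopes of the variables $x_1,\dots,x_n$). The sequence $(e_1,\dots,e_n)$ is a regular sequence of polytopes on the polytope semiring $\mathcal{A}$.
   Context: $\mathcal{A}$: lattice polytopes with vertices in $\mathbb{Z}^n_{\ge0}$ plus $0_{\mathcal{A}}$; $\oplus$ = convex hull of union, $\odot$ = Minkowski sum, $0_{\mathcal{A}}$ additive identity and absorbing. $C(P_1,\dots,P_k)$ is the set of all $\bigoplus_j(R_j\odot P_j)$, $R_j\in\mathcal{A}$. A sequence $(P_1,\dots,P_r)$ is regular if for every $i=2,\dots,r$ and every $Q\in\mathcal{A}$ with $Q\notin C(P_1,\dots,P_{i-1})$, $Q\odot P_i\notin C(P_1,\dots,P_{i-1})$. -}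

module Defs where

open import Data.Nat using (ℕ; suc; _≤_)
open import Data.Fin using (Fin; toℕ; _≟_)
open import Data.List using (List; []; _∷_; _++_; map; concatMap; length; zipWith; foldr; lookup; take; allFin)
open import Data.List.Relation.Unary.All using (All)
open import Data.Rational using (ℚ; 0ℚ; 1ℚ; _+_; _*_; _/_)
import Data.Rational as ℚ
open import Data.Integer using (+_)
open import Data.Product using (Σ; ∃; _×_)
open import Relation.Binary.PropositionalEquality using (_≡_)
open import Relation.Nullary using (¬_; yes; no)
open import Function.Bundles using (_⇔_)

Point : ℕ → Set
Point n = Fin n → ℕ

-- A lattice polytope is presented by a finite list of generating lattice
-- points (its convex hull).  The empty list presents the empty polytope,
-- which plays the role of 0_A (additive identity and absorbing for ⊙).
Poly : ℕ → Set
Poly n = List (Point n)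

0A : ∀ {n} → Poly n
0A = []

QPoint : ℕ → Set
QPoint n = Fin n → ℚ

toℚ : ℕ → ℚ
toℚ k = + k / 1

sumℚ : List ℚ → ℚ
sumℚ = foldr _+_ 0ℚ

InHull : ∀ {n} → Poly n → QPoint n → Set
InHull {n} S x =
  Σ (List ℚ) λ w →
    length w ≡ length S ×
    All (0ℚ ℚ.≤_) w ×
    sumℚ w ≡ 1ℚ ×
    (∀ (k : Fin n) → x k ≡ sumℚ (zipWith (λ c p → c * toℚ (p k)) w S))

-- Equality of polytopes = equality of convex hulls (as sets of rational
-- points; polytopes with rational vertices are determined by these).
_≈P_ : ∀ {n} → Poly n → Poly n → Set
_≈P_ {n} P Q = ∀ (x : QPoint n) → InHull P x ⇔ InHull Q x

_⊕_ : ∀ {n} → Poly n → Poly n → Poly n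
P ⊕ Q = P ++ Q

addPt : ∀ {n} → Point n → Point n → Point n
addPt p q k = p k Data.Nat.+ q k

_⊙_ : ∀ {n} → Poly n → Poly n → Poly n
P ⊙ Q = concatMap (λ p → map (addPt p) Q) P

InC : ∀ {n} → List (Poly n) → Poly n → Set
InC {n} Ps Q =
  Σ (List (Poly n)) λ Rs →
    length Rs ≡ length Ps × (Q ≈P foldr _⊕_ 0A (zipWith _⊙_ Rs Ps))

-- Regular sequence (P_1,…,P_r): for i = 2,…,r (0-based index i with
-- 1 ≤ toℕ i), the prefix is take (toℕ i) Ps = (P_1,…,P_{i-1}).
Regular : ∀ {n} → List (Poly n) → Set
Regular {n} Ps =
  ∀ (i : Fin (length Ps)) → 1 ≤ toℕ i →
  ∀ (Q : Poly n) →
    ¬ InC (take (toℕ i) Ps) Q →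
    ¬ InC (take (toℕ i) Ps) (Q ⊙ lookup Ps i)

unitPt : ∀ {n} → Fin n → Point n
unitPt j k with j ≟ k
... | yes _ = 1
... | no _ = 0

e : ∀ {n} → Fin n → Poly n
e j = unitPt j ∷ []

coordSeq : ∀ n → List (Poly n)
coordSeq n = map e (allFin n)

-- Read a point p ∈ ℕⁿ as the monomial x^p.  Fix coordinates ks and m ∉ ks.
-- Every generator of a polytope ⊕ⱼ Rⱼ ⊙ e_{kⱼ} (kⱼ ∈ ks) is divisible by some x_k with
-- k ∈ ks, and so has a coordinate k ∈ ks that is at least 1.  A convex combination of such
-- points has positive weight on some point, hence is nonzero in some coordinate k ∈ ks.
-- So if Q ⊙ e_m lies in C(e_ks), every generator q of Q is divisible by some x_k (k ∈ ks):
-- otherwise q + e_m vanishes on ks.  But then Q = ⊕_{k ∈ ks} (Q / x_k) ⊙ e_k, where Q / x_k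
-- collects q − e_k for the generators q divisible by x_k, so Q itself lies in C(e_ks).

module Submission where

open import Defs
open import Data.Nat as ℕ using (ℕ; zero; suc; _∸_)
import Data.Nat.Properties as ℕ
open import Data.Fin as Fin using (Fin; toℕ)
open import Data.List using (List; []; _∷_; map; foldr; zipWith; replicate; filter; take; tabulate; allFin; lookup; length)
import Data.List.Properties as List
open import Data.List.Membership.Propositional using (_∈_; _∉_; find; lose)
open import Data.List.Membership.Propositional.Properties using (∈-map⁺; ∈-map⁻; ∈-filter⁺; ∈-filter⁻)
open import Data.List.Relation.Unary.All as All using (All; []; _∷_)
import Data.List.Relation.Unary.All.Properties as All
open import Data.List.Relation.Unary.Any as Any using (Any; here; there)
import Data.List.Relation.Unary.Any.Properties as Any
open import Data.Rational using (ℚ; 0ℚ; 1ℚ; _+_; _*_; _≤_; nonNegative)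
import Data.Rational.Properties as ℚ
open import Algebra.Bundles using (CommutativeMonoid)
open import Algebra.Properties.CommutativeSemigroup
  (CommutativeMonoid.commutativeSemigroup ℚ.+-0-commutativeMonoid) using (interchange)
open import Data.Product using (∃-syntax; _×_; _,_; proj₁; proj₂)
open import Data.Sum using (inj₁; inj₂)
open import Data.Empty using (⊥-elim)
open import Function using (id; _∘_)
open import Function.Bundles using (Equivalence; mk⇔)
open import Relation.Binary.PropositionalEquality
open import Relation.Nullary using (¬_; yes; no)

toQPoint : ∀ {n} → Point n → QPoint n
toQPoint p k = toℚ (p k)

combination : ∀ {n} → List ℚ → Poly n → Fin n → ℚ
combination w S k = sumℚ (zipWith (λ c p → c * toℚ (p k)) w S)

-- Non-negative combinations of S of total weight s; InHull S is definitionally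
-- InScaledHull S 1ℚ.  Allowing any s lets combinations be added and scaled without division.
InScaledHull : ∀ {n} → Poly n → ℚ → QPoint n → Set
InScaledHull S s x =
  ∃[ w ] length w ≡ length S × All (0ℚ ≤_) w × sumℚ w ≡ s × (∀ k → x k ≡ combination w S k)

sumℚ-replicate-0 : ∀ m → sumℚ (replicate m 0ℚ) ≡ 0ℚ
sumℚ-replicate-0 zero = refl
sumℚ-replicate-0 (suc m) = trans (cong (0ℚ +_) (sumℚ-replicate-0 m)) (ℚ.+-identityˡ 0ℚ)

sumℚ-map-* : ∀ c w → sumℚ (map (c *_) w) ≡ c * sumℚ w
sumℚ-map-* c [] = sym (ℚ.*-zeroʳ c)
sumℚ-map-* c (a ∷ w) = trans (cong (c * a +_) (sumℚ-map-* c w)) (sym (ℚ.*-distribˡ-+ c a (sumℚ w)))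

sumℚ-zipWith-+ : ∀ v w → length v ≡ length w → sumℚ (zipWith _+_ v w) ≡ sumℚ v + sumℚ w
sumℚ-zipWith-+ [] [] _ = sym (ℚ.+-identityˡ 0ℚ)
sumℚ-zipWith-+ (a ∷ v) (b ∷ w) |v|≡|w| =
  trans (cong (a + b +_) (sumℚ-zipWith-+ v w (ℕ.suc-injective |v|≡|w|)))
        (interchange a b (sumℚ v) (sumℚ w))

combination-replicate-0 : ∀ {n} m (S : Poly n) k → combination (replicate m 0ℚ) S k ≡ 0ℚ
combination-replicate-0 zero S k = refl
combination-replicate-0 (suc m) [] k = refl
combination-replicate-0 (suc m) (p ∷ S) k =
  trans (cong₂ _+_ (ℚ.*-zeroˡ (toℚ (p k))) (combination-replicate-0 m S k)) (ℚ.+-identityˡ 0ℚ)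

combination-map-* : ∀ {n} c w (S : Poly n) k → combination (map (c *_) w) S k ≡ c * combination w S k
combination-map-* c [] S k = sym (ℚ.*-zeroʳ c)
combination-map-* c (a ∷ w) [] k = sym (ℚ.*-zeroʳ c)
combination-map-* c (a ∷ w) (p ∷ S) k =
  trans (cong₂ _+_ (ℚ.*-assoc c a (toℚ (p k))) (combination-map-* c w S k))
        (sym (ℚ.*-distribˡ-+ c (a * toℚ (p k)) (combination w S k)))

combination-zipWith-+ : ∀ {n} v w (S : Poly n) k → length v ≡ length w →
  combination (zipWith _+_ v w) S k ≡ combination v S k + combination w S k
combination-zipWith-+ [] [] S k _ = refl
combination-zipWith-+ (a ∷ v) (b ∷ w) [] k _ = refl
combination-zipWith-+ (a ∷ v) (b ∷ w) (p ∷ S) k |v|≡|w| =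
  trans (cong₂ _+_ (ℚ.*-distribʳ-+ (toℚ (p k)) a b)
                   (combination-zipWith-+ v w S k (ℕ.suc-injective |v|≡|w|)))
        (interchange (a * toℚ (p k)) (b * toℚ (p k)) (combination v S k) (combination w S k))

0≤* : ∀ {a b} → 0ℚ ≤ a → 0ℚ ≤ b → 0ℚ ≤ a * b
0≤* {a} {b} 0≤a 0≤b =
  ℚ.nonNegative⁻¹ (a * b) {{ℚ.nonNeg*nonNeg⇒nonNeg a {{nonNegative 0≤a}} b {{nonNegative 0≤b}}}}

0≤toℚ : ∀ m → 0ℚ ≤ toℚ m
0≤toℚ m = ℚ.nonNegative⁻¹ (toℚ m) {{ℚ.normalize-nonNeg m 1}}

All-0≤-zipWith-+ : ∀ {v w} → All (0ℚ ≤_) v → All (0ℚ ≤_) w → All (0ℚ ≤_) (zipWith _+_ v w)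
All-0≤-zipWith-+ [] _ = []
All-0≤-zipWith-+ (_ ∷ _) [] = []
All-0≤-zipWith-+ (0≤a ∷ 0≤v) (0≤b ∷ 0≤w) = ℚ.+-mono-≤ 0≤a 0≤b ∷ All-0≤-zipWith-+ 0≤v 0≤w

0≤combination : ∀ {n} w (S : Poly n) k → All (0ℚ ≤_) w → 0ℚ ≤ combination w S k
0≤combination [] S k _ = ℚ.≤-refl
0≤combination (c ∷ w) [] k _ = ℚ.≤-refl
0≤combination (c ∷ w) (p ∷ S) k (0≤c ∷ 0≤w) =
  ℚ.+-mono-≤ (0≤* 0≤c (0≤toℚ (p k))) (0≤combination w S k 0≤w)

InScaledHull-cong : ∀ {n} {S : Poly n} {s t x y} → s ≡ t → (∀ k → x k ≡ y k) →
  InScaledHull S s x → InScaledHull S t y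
InScaledHull-cong s≡t x≗y (w , |w| , 0≤w , Σw , x≡) =
  w , |w| , 0≤w , trans Σw s≡t , λ k → trans (sym (x≗y k)) (x≡ k)

InScaledHull-zero : ∀ {n} (S : Poly n) → InScaledHull S 0ℚ (λ _ → 0ℚ)
InScaledHull-zero S =
  replicate (length S) 0ℚ , List.length-replicate (length S) , All.replicate⁺ (length S) ℚ.≤-refl ,
  sumℚ-replicate-0 (length S) , λ k → sym (combination-replicate-0 (length S) S k)

InScaledHull-* : ∀ {n} {S : Poly n} {s x} c → 0ℚ ≤ c →
  InScaledHull S s x → InScaledHull S (c * s) (λ k → c * x k)
InScaledHull-* {S = S} c 0≤c (w , |w| , 0≤w , Σw , x≡) =
  map (c *_) w , trans (List.length-map (c *_) w) |w| , All.map⁺ (All.map (0≤* 0≤c) 0≤w) ,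
  trans (sumℚ-map-* c w) (cong (c *_) Σw) ,
  λ k → trans (cong (c *_) (x≡ k)) (sym (combination-map-* c w S k))

InScaledHull-+ : ∀ {n} {S : Poly n} {s t x y} →
  InScaledHull S s x → InScaledHull S t y → InScaledHull S (s + t) (λ k → x k + y k)
InScaledHull-+ {S = S} (v , |v| , 0≤v , Σv , x≡) (w , |w| , 0≤w , Σw , y≡) =
  zipWith _+_ v w ,
  trans (List.length-zipWith _+_ v w) (trans (cong₂ ℕ._⊓_ |v| |w|) (ℕ.⊓-idem (length S))) ,
  All-0≤-zipWith-+ 0≤v 0≤w ,
  trans (sumℚ-zipWith-+ v w |v|≡|w|) (cong₂ _+_ Σv Σw) ,
  λ k → trans (cong₂ _+_ (x≡ k) (y≡ k)) (sym (combination-zipWith-+ v w S k |v|≡|w|))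
  where |v|≡|w| = trans |v| (sym |w|)

InScaledHull-mono : ∀ {n} {A B : Poly n} → All (InHull B ∘ toQPoint) A →
  ∀ {s x} → InScaledHull A s x → InScaledHull B s x
InScaledHull-mono {B = B} [] ([] , _ , _ , Σw , x≡) =
  InScaledHull-cong Σw (λ k → sym (x≡ k)) (InScaledHull-zero B)
InScaledHull-mono {A = a ∷ A} (a∈B ∷ A⊆B) (c ∷ w , |w| , 0≤c ∷ 0≤w , Σw , x≡) =
  InScaledHull-cong (trans (cong (_+ sumℚ w) (ℚ.*-identityʳ c)) Σw) (λ k → sym (x≡ k))
    (InScaledHull-+ (InScaledHull-* c 0≤c a∈B)
                    (InScaledHull-mono A⊆B (w , ℕ.suc-injective |w| , 0≤w , refl , λ _ → refl)))

≈P-fromGenerators : ∀ {n} {A B : Poly n} →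
  All (InHull B ∘ toQPoint) A → All (InHull A ∘ toQPoint) B → A ≈P B
≈P-fromGenerators A⊆B B⊆A x = mk⇔ (InScaledHull-mono A⊆B) (InScaledHull-mono B⊆A)

generator⇒InHull : ∀ {n} {a : Point n} {B : Poly n} → Any (a ≗_) B → InHull B (toQPoint a)
generator⇒InHull {a = a} {B = b ∷ B} (here a≗b) =
  1ℚ ∷ replicate (length B) 0ℚ , cong suc (List.length-replicate (length B)) ,
  ℚ.nonNegative⁻¹ 1ℚ ∷ All.replicate⁺ (length B) ℚ.≤-refl ,
  trans (cong (1ℚ +_) (sumℚ-replicate-0 (length B))) (ℚ.+-identityʳ 1ℚ) ,
  λ k → begin
    toℚ (a k)                                                    ≡⟨ cong toℚ (a≗b k) ⟩
    toℚ (b k)                                                    ≡⟨ sym (ℚ.*-identityˡ _) ⟩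
    1ℚ * toℚ (b k)                                               ≡⟨ sym (ℚ.+-identityʳ _) ⟩
    1ℚ * toℚ (b k) + 0ℚ                                          ≡⟨ cong (1ℚ * toℚ (b k) +_)
                                                                      (sym (combination-replicate-0 (length B) B k)) ⟩
    1ℚ * toℚ (b k) + combination (replicate (length B) 0ℚ) B k   ∎
  where open ≡-Reasoning
generator⇒InHull {B = b ∷ B} (there a∈B) =
  let w , |w| , 0≤w , Σw , x≡ = generator⇒InHull a∈B in
  0ℚ ∷ w , cong suc |w| , ℚ.≤-refl ∷ 0≤w , trans (ℚ.+-identityˡ (sumℚ w)) Σw ,
  λ k → trans (x≡ k) (sym (trans (cong (_+ combination w B k) (ℚ.*-zeroˡ (toℚ (b k))))
                                 (ℚ.+-identityˡ (combination w B k))))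

*-≡0⇒≡0 : ∀ {c} m → 0ℚ ≤ c → 1 ℕ.≤ m → c * toℚ m ≡ 0ℚ → c ≡ 0ℚ
*-≡0⇒≡0 {c} (suc m) 0≤c _ c*m≡0 = ℚ.≤-antisym
  (ℚ.*-cancelʳ-≤-pos (toℚ (suc m)) {{ℚ.normalize-pos (suc m) 1}}
    (ℚ.≤-reflexive (trans c*m≡0 (sym (ℚ.*-zeroˡ (toℚ (suc m)))))))
  0≤c

+-≡0⇒≡0 : ∀ {a b} → 0ℚ ≤ a → 0ℚ ≤ b → a + b ≡ 0ℚ → a ≡ 0ℚ × b ≡ 0ℚ
+-≡0⇒≡0 {a} {b} 0≤a 0≤b a+b≡0 = a≡0 , trans (sym (ℚ.+-identityˡ b)) (trans (cong (_+ b) (sym a≡0)) a+b≡0)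
  where
  a≤a+b : a ≤ a + b
  a≤a+b = ℚ.≤-trans (ℚ.≤-reflexive (sym (ℚ.+-identityʳ a))) (ℚ.+-monoʳ-≤ a 0≤b)
  a≡0 = ℚ.≤-antisym (ℚ.≤-trans a≤a+b (ℚ.≤-reflexive a+b≡0)) 0≤a

DivisibleBySome : ∀ {n} → List (Fin n) → Point n → Set
DivisibleBySome ks p = Any (λ k → 1 ℕ.≤ p k) ks

InScaledHull-mass-zero : ∀ {n} {ks : List (Fin n)} {G : Poly n} {s x} →
  All (DivisibleBySome ks) G → InScaledHull G s x → (∀ k → k ∈ ks → x k ≡ 0ℚ) → s ≡ 0ℚ
InScaledHull-mass-zero [] ([] , _ , _ , Σw , _) _ = sym Σw
InScaledHull-mass-zero {ks = ks} {G = g ∷ G} (g∣ ∷ G∣) (c ∷ w , |w| , 0≤c ∷ 0≤w , Σw , x≡) x≡0 =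
  trans (sym Σw) (trans (cong₂ _+_ c≡0 Σw≡0) (ℚ.+-identityˡ 0ℚ))
  where
  parts : ∀ k → k ∈ ks → c * toℚ (g k) ≡ 0ℚ × combination w G k ≡ 0ℚ
  parts k k∈ks = +-≡0⇒≡0 (0≤* 0≤c (0≤toℚ (g k))) (0≤combination w G k 0≤w)
                         (trans (sym (x≡ k)) (x≡0 k k∈ks))
  c≡0 : c ≡ 0ℚ
  c≡0 = let k , k∈ks , 1≤gk = find g∣ in *-≡0⇒≡0 (g k) 0≤c 1≤gk (proj₁ (parts k k∈ks))
  Σw≡0 : sumℚ w ≡ 0ℚ
  Σw≡0 = InScaledHull-mass-zero G∣ (w , ℕ.suc-injective |w| , 0≤w , refl , λ _ → refl)
                                   (λ k k∈ks → proj₂ (parts k k∈ks))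

unitPt-diag : ∀ {n} (k : Fin n) → unitPt k k ≡ 1
unitPt-diag k with k Fin.≟ k
... | yes _ = refl
... | no k≢k = ⊥-elim (k≢k refl)

unitPt-off : ∀ {n} {j k : Fin n} → j ≢ k → unitPt j k ≡ 0
unitPt-off {j = j} {k} j≢k with j Fin.≟ k
... | yes j≡k = ⊥-elim (j≢k j≡k)
... | no _ = refl

unitPt-≤ : ∀ {n} {q : Point n} k → 1 ℕ.≤ q k → ∀ j → unitPt k j ℕ.≤ q j
unitPt-≤ k 1≤qk j with k Fin.≟ j
... | yes refl = 1≤qk
... | no _ = ℕ.z≤n

lowerAt : ∀ {n} → Fin n → Point n → Point n
lowerAt k q j = q j ∸ unitPt k j

addPt-lowerAt : ∀ {n} {q : Point n} k → 1 ℕ.≤ q k → addPt (lowerAt k q) (unitPt k) ≗ q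
addPt-lowerAt k 1≤qk j = ℕ.m∸n+n≡m (unitPt-≤ k 1≤qk j)

1≤addPt-unitPt : ∀ {n} (r : Point n) k → 1 ℕ.≤ addPt r (unitPt k) k
1≤addPt-unitPt r k = subst (1 ℕ.≤_) (cong (r k ℕ.+_) (sym (unitPt-diag k))) (ℕ.m≤n+m 1 (r k))

⊙-singleton : ∀ {n} (R : Poly n) u → R ⊙ (u ∷ []) ≡ map (λ r → addPt r u) R
⊙-singleton [] u = refl
⊙-singleton (r ∷ R) u = cong (addPt r u ∷_) (⊙-singleton R u)

∈-⊙-singleton⁺ : ∀ {n} {R : Poly n} {r} u → r ∈ R → addPt r u ∈ R ⊙ (u ∷ [])
∈-⊙-singleton⁺ {R = R} u r∈R rewrite ⊙-singleton R u = ∈-map⁺ (λ r → addPt r u) r∈R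

linearCombination : ∀ {n} → List (Poly n) → List (Poly n) → Poly n
linearCombination Rs Ps = foldr _⊕_ 0A (zipWith _⊙_ Rs Ps)

linearCombination-divisible : ∀ {n} (Rs : List (Poly n)) ks →
  All (DivisibleBySome ks) (linearCombination Rs (map e ks))
linearCombination-divisible [] ks = []
linearCombination-divisible (R ∷ Rs) [] = []
linearCombination-divisible (R ∷ Rs) (k ∷ ks) =
  All.++⁺ (subst (All (DivisibleBySome (k ∷ ks))) (sym (⊙-singleton R (unitPt k)))
                 (All.map⁺ (All.universal (λ r → here (1≤addPt-unitPt r k)) R)))
          (All.map there (linearCombination-divisible Rs ks))

Any-linearCombination⁺ : ∀ {n} {P : Point n → Set} (R : Fin n → Poly n) {k ks} → k ∈ ks →
  Any P (R k ⊙ e k) → Any P (linearCombination (map R ks) (map e ks))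
Any-linearCombination⁺ R (here refl) p = Any.++⁺ˡ p
Any-linearCombination⁺ R {ks = k′ ∷ _} (there k∈ks) p =
  Any.++⁺ʳ (R k′ ⊙ e k′) (Any-linearCombination⁺ R k∈ks p)

Any-linearCombination⁻ : ∀ {n} {P : Point n → Set} (R : Fin n → Poly n) ks →
  Any P (linearCombination (map R ks) (map e ks)) → ∃[ k ] k ∈ ks × Any P (R k ⊙ e k)
Any-linearCombination⁻ R (k ∷ ks) p with Any.++⁻ (R k ⊙ e k) p
... | inj₁ p₁ = k , here refl , p₁
... | inj₂ p₂ = let k′ , k′∈ks , p′ = Any-linearCombination⁻ R ks p₂ in k′ , there k′∈ks , p′

divideBy : ∀ {n} → Fin n → Poly n → Poly n
divideBy k Q = map (lowerAt k) (filter (λ q → 1 ℕ.≤? q k) Q)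

divideBy-⊙⁺ : ∀ {n} {Q : Poly n} {q} k → q ∈ Q → 1 ℕ.≤ q k → Any (q ≗_) (divideBy k Q ⊙ e k)
divideBy-⊙⁺ k q∈Q 1≤qk =
  lose (∈-⊙-singleton⁺ (unitPt k) (∈-map⁺ (lowerAt k) (∈-filter⁺ (λ q → 1 ℕ.≤? q k) q∈Q 1≤qk)))
       (sym ∘ addPt-lowerAt k 1≤qk)

divideBy-⊙⁻ : ∀ {n} {Q : Poly n} {y} k → y ∈ divideBy k Q ⊙ e k → Any (y ≗_) Q
divideBy-⊙⁻ {Q = Q} k y∈ rewrite ⊙-singleton (divideBy k Q) (unitPt k)
  with r , r∈ , refl ← ∈-map⁻ (λ r → addPt r (unitPt k)) y∈
  with q , q∈ , refl ← ∈-map⁻ (lowerAt k) r∈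
  with q∈Q , 1≤qk ← ∈-filter⁻ (λ q → 1 ℕ.≤? q k) q∈ = lose q∈Q (addPt-lowerAt k 1≤qk)

divisible⇒InC : ∀ {n} {ks : List (Fin n)} {Q : Poly n} → All (DivisibleBySome ks) Q → InC (map e ks) Q
divisible⇒InC {ks = ks} {Q} Q∣ =
  map R ks , trans (List.length-map R ks) (sym (List.length-map e ks)) , ≈P-fromGenerators Q⊆ ⊆Q
  where
  R : Fin _ → Poly _
  R k = divideBy k Q
  Q⊆ : All (InHull (linearCombination (map R ks) (map e ks)) ∘ toQPoint) Q
  Q⊆ = All.tabulate λ q∈Q → let k , k∈ks , 1≤qk = find (All.lookup Q∣ q∈Q) in
    generator⇒InHull (Any-linearCombination⁺ R k∈ks (divideBy-⊙⁺ k q∈Q 1≤qk))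
  ⊆Q : All (InHull Q ∘ toQPoint) (linearCombination (map R ks) (map e ks))
  ⊆Q = All.tabulate λ y∈ → let k , _ , y∈′ = Any-linearCombination⁻ R ks y∈ in
    generator⇒InHull (divideBy-⊙⁻ k y∈′)

¬InC-⊙-e : ∀ {n} {ks : List (Fin n)} {m} (Q : Poly n) → m ∉ ks →
  ¬ InC (map e ks) Q → ¬ InC (map e ks) (Q ⊙ e m)
¬InC-⊙-e {ks = ks} {m} Q m∉ks Q∉C (Rs , _ , Q⊙e≈) = Q∉C (divisible⇒InC (All.tabulate divisible))
  where
  divisible : ∀ {q} → q ∈ Q → DivisibleBySome ks q
  divisible {q} q∈Q with Any.any? (λ k → 1 ℕ.≤? q k) ks
  ... | yes q∣ = q∣
  ... | no q∤ = ⊥-elim (1ℚ≢0ℚ (InScaledHull-mass-zero (linearCombination-divisible Rs ks) qe∈C vanishes))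
    where
    1ℚ≢0ℚ : 1ℚ ≢ 0ℚ
    1ℚ≢0ℚ ()
    qe∈C : InHull (linearCombination Rs (map e ks)) (toQPoint (addPt q (unitPt m)))
    qe∈C = Equivalence.to (Q⊙e≈ _) (generator⇒InHull (lose (∈-⊙-singleton⁺ (unitPt m) q∈Q) (λ _ → refl)))
    vanishes : ∀ k → k ∈ ks → toℚ (q k ℕ.+ unitPt m k) ≡ 0ℚ
    vanishes k k∈ks = cong toℚ (cong₂ ℕ._+_ (ℕ.n<1⇒n≡0 (ℕ.≰⇒> (q∤ ∘ lose k∈ks)))
                                            (unitPt-off λ { refl → m∉ks k∈ks }))

∈-take-tabulate⁻ : ∀ {A : Set} {n} (f : Fin n → A) t {x} →
  x ∈ take t (tabulate f) → ∃[ j ] toℕ j ℕ.< t × x ≡ f j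
∈-take-tabulate⁻ {n = suc n} f (suc t) (here x≡) = Fin.zero , ℕ.s≤s ℕ.z≤n , x≡
∈-take-tabulate⁻ {n = suc n} f (suc t) (there x∈) =
  let j , j<t , x≡ = ∈-take-tabulate⁻ (f ∘ Fin.suc) t x∈ in Fin.suc j , ℕ.s≤s j<t , x≡

∉-take-allFin : ∀ {n} (m : Fin n) → m ∉ take (toℕ m) (allFin n)
∉-take-allFin m m∈ with j , j<m , refl ← ∈-take-tabulate⁻ id (toℕ m) m∈ = ℕ.<-irrefl refl j<m

lookup-map-tabulate : ∀ {A B : Set} {n} (g : A → B) (f : Fin n → A) (i : Fin (length (map g (tabulate f)))) →
  ∃[ j ] toℕ j ≡ toℕ i × lookup (map g (tabulate f)) i ≡ g (f j)
lookup-map-tabulate {n = suc n} g f Fin.zero = Fin.zero , refl , refl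
lookup-map-tabulate {n = suc n} g f (Fin.suc i) =
  let j , j≡i , lookup≡ = lookup-map-tabulate g (f ∘ Fin.suc) i in Fin.suc j , cong suc j≡i , lookup≡

mainTheorem14 : ∀ (n : ℕ) → Regular (coordSeq n)
mainTheorem14 n i _ Q Q∉C QP∈C with m , m≡i , P≡em ← lookup-map-tabulate e id i =
  ¬InC-⊙-e Q (subst (λ t → m ∉ take t (allFin n)) m≡i (∉-take-allFin m))
    (subst (λ Ps → ¬ InC Ps Q) prefix Q∉C)
    (subst (λ Ps → InC Ps (Q ⊙ e m)) prefix (subst (λ P → InC (take (toℕ i) (coordSeq n)) (Q ⊙ P)) P≡em QP∈C))
  where
  prefix : take (toℕ i) (coordSeq n) ≡ map e (take (toℕ i) (allFin n))
  prefix = List.take-map (toℕ i) (allFin n)
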